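{- Let $G$ be a bipartite cactus graph and let $c$ be a difference-1 colouring of $G$. Then $G^c$ is configurable.
   Context: A cactus graph is a connected finite graph in which any two distinct cycles share at most one vertex. A colouring of $G$ is a map $c:E(G)\to\{\text{blue},\text{red}\}$, and $G^c$ denotes $G$ with edges so coloured; $\deg^B(v)$ and $\deg^R(v)$ denote the numbers of blue and red edges incident with $v$. The colouring $c$ is a difference-1 colouring if $\deg^B(v)-\deg^R(v)=1$ for every vertex $v$. $G^c$ is configurable if there exists a linear ordering of $V(G)$ such that for every vertex $u$, if the neighbours of $u$ listed in this order are $v_1,\dots,v_k$, then the edges $uv_1,\dots,uv_k$ alternate in colour, starting and ending with blue. -}

module Defs where

open import Data.Nat using (ℕ; zero; suc; _+_; _≤_)
open import Data.Fin using (Fin; zero; suc; inject₁; fromℕ)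
open import Data.Bool using (Bool; true; false; if_then_else_; T; not)
open import Data.List using (List; []; _∷_; allFin; map)
open import Data.Nat.ListAction using (sum)
open import Data.List.Membership.Propositional using (_∈_)
open import Data.List.Relation.Unary.Unique.Propositional using (Unique)
open import Data.Product using (Σ; _×_; ∃; _,_)
import Data.Product
open import Data.Sum using (_⊎_)
open import Relation.Binary.PropositionalEquality using (_≡_; _≢_)
open import Relation.Nullary using (¬_)
open import Function.Bundles using (_⇔_)

record Graph (n : ℕ) : Set where
  field
    adj    : Fin n → Fin n → Bool
    sym    : ∀ u v → adj u v ≡ adj v u
    irrefl : ∀ v → adj v v ≡ false
open Graph public

module _ {n : ℕ} (G : Graph n) where

  data Walk : Fin n → Fin n → Set where
    here : ∀ {u} → Walk u u
    step : ∀ {u v w} → T (adj G u v) → Walk v w → Walk u w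

  Connected : Set
  Connected = ∀ u v → Walk u v

  Bipartite : Set
  Bipartite = Σ (Fin n → Bool) λ side → ∀ u v → T (adj G u v) → side u ≡ not (side v)

  -- A cycle v_0 v_1 ... v_m v_0 of length m+1 ≥ 3 with distinct vertices.
  record Cycle : Set where
    field
      len-2    : ℕ                       -- m = length - 1
      long     : 2 ≤ len-2
      vert     : Fin (suc len-2) → Fin n
      distinct : ∀ i j → vert i ≡ vert j → i ≡ j
      consec   : ∀ (i : Fin len-2) → T (adj G (vert (inject₁ i)) (vert (suc i)))
      closing  : T (adj G (vert (fromℕ len-2)) (vert zero))
  open Cycle public

  SamePair : Fin n → Fin n → Fin n → Fin n → Set
  SamePair u v a b = (u ≡ a × v ≡ b) ⊎ (u ≡ b × v ≡ a)

  CycleEdge : Cycle → Fin n → Fin n → Set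
  CycleEdge C u v =
    (Σ (Fin (len-2 C)) λ i → SamePair u v (vert C (inject₁ i)) (vert C (suc i)))
    ⊎ SamePair u v (vert C (fromℕ (len-2 C))) (vert C zero)

  OnCycle : Cycle → Fin n → Set
  OnCycle C x = Σ (Fin (suc (len-2 C))) λ i → vert C i ≡ x

  -- cycles are distinct as subgraphs: different edge sets
  DistinctCycles : Cycle → Cycle → Set
  DistinctCycles C D = ¬ (∀ u v → CycleEdge C u v ⇔ CycleEdge D u v)

  Cactus : Set
  Cactus = Connected ×
    (∀ (C D : Cycle) → DistinctCycles C D →
      ∀ x y → OnCycle C x → OnCycle D x → OnCycle C y → OnCycle D y → x ≡ y)

data Colour : Set where
  blue red : Colour

isBlue : Colour → Bool
isBlue blue = true
isBlue red  = false

isRed : Colour → Bool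
isRed c = not (isBlue c)

module _ {n : ℕ} (G : Graph n) where

  -- an edge colouring, given as a symmetric function on pairs
  -- (only its values on edges matter)
  Colouring : Set
  Colouring = Σ (Fin n → Fin n → Colour) λ c → ∀ u v → c u v ≡ c v u

  countIf : (Fin n → Bool) → ℕ
  countIf p = sum (map (λ u → if p u then 1 else 0) (allFin n))

  degB : Colouring → Fin n → ℕ
  degB (c , _) v = countIf (λ u → if adj G v u then isBlue (c v u) else false)

  degR : Colouring → Fin n → ℕ
  degR (c , _) v = countIf (λ u → if adj G v u then isRed (c v u) else false)

  Difference1 : Colouring → Set
  Difference1 χ = ∀ v → degB χ v ≡ suc (degR χ v)

  nbrColours : Colouring → Fin n → List (Fin n) → List Colour
  nbrColours χ u [] = []
  nbrColours χ u (v ∷ vs) =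
    if adj G u v then Data.Product.proj₁ χ u v ∷ nbrColours χ u vs else nbrColours χ u vs

  data AltBlue : List Colour → Set where
    single : AltBlue (blue ∷ [])
    more   : ∀ {cs} → AltBlue cs → AltBlue (blue ∷ red ∷ cs)

  LinearOrder : Set
  LinearOrder = Σ (List (Fin n)) λ ord → Unique ord × (∀ v → v ∈ ord)

  Configurable : Colouring → Set
  Configurable χ = Σ LinearOrder λ o → ∀ u → AltBlue (nbrColours χ u (Data.Product.proj₁ o))

module Submission where

-- Let A ∪ B be the bipartition. It suffices to list B so that every vertex of A sees its edges
-- alternate blue, red, …, blue, and symmetrically for A: B's list followed by A's list is then the
-- ordering, because all neighbours of a vertex lie on the other side.
-- The vertices of A are processed one at a time, starting from a root, each next one adjacent to an
-- already listed vertex (the graph is connected). When a is processed, at most two of its neighbours are already listed: three of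
-- them, each joined to the root avoiding a, would close two cycles sharing a and a neighbour of a.
-- Since deg^B(a) = deg^R(a) + 1, the other neighbours of a can be placed before, between and after
-- those two so that a sees alternating colours, and earlier vertices of A see no change because all
-- their neighbours were already listed.

open import Defs hiding (sym)

open import Data.Bool using (Bool; true; false; if_then_else_; T; not)
import Data.Bool as Bool
open import Data.Bool.Properties using (T?; not-involutive; not-¬)
open import Data.Empty using (⊥; ⊥-elim)
open import Data.Fin using (Fin; zero; suc; inject₁; fromℕ; _≟_)
import Data.Fin.Properties as Fin
open import Data.List using (List; []; _∷_; _++_; map; filter; length; allFin)
import Data.List.Properties as List
open import Data.List.Membership.Propositional using (_∈_; _∉_; find; lose)
open import Data.List.Membership.Propositional.Properties
  using (∈-++⁻; ∈-++⁺ˡ; ∈-++⁺ʳ; ∈-filter⁺; ∈-filter⁻; ∈-allFin)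
open import Data.List.Membership.Propositional.Properties.WithK using (unique∧set⇒bag)
open import Data.List.Relation.Binary.BagAndSetEquality using (∼bag⇒↭)
open import Data.List.Relation.Binary.Disjoint.Propositional using (Disjoint)
open import Data.List.Relation.Binary.Permutation.Propositional
  using (_↭_; prep; ↭-refl; ↭-sym; ↭-trans; ↭⇒↭ₛ; module PermutationReasoning)
import Data.List.Relation.Binary.Permutation.Propositional.Properties as ↭
open import Data.List.Relation.Binary.Permutation.Propositional.Properties
  using (shift; ++-identityʳ; ++-comm; ↭-length; ++⁺ˡ; ++⁺ʳ; ∈-resp-↭)
import Data.List.Relation.Binary.Permutation.Setoid.Properties as ↭ₛ
open import Data.List.Relation.Binary.Subset.Propositional using (_⊆_)
open import Data.List.Relation.Unary.All as All using (All; []; _∷_)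
open import Data.List.Relation.Unary.All.Properties using (++⁻ˡ; ++⁻ʳ)
open import Data.List.Relation.Unary.All.Properties.Core using (¬Any⇒All¬)
open import Data.List.Relation.Unary.AllPairs using ([]; _∷_)
open import Data.List.Relation.Unary.Any using (Any; here; there; any?)
open import Data.List.Relation.Unary.Unique.Propositional using (Unique)
import Data.List.Relation.Unary.Unique.Propositional.Properties as Unique
open import Data.Nat using (ℕ; zero; suc; _+_; _≤_; s≤s; z≤n)
open import Data.Nat.ListAction using (sum)
open import Data.Nat.ListAction.Properties using (sum-++; sum-↭)
open import Data.Nat.Properties using (m≤m+n; suc-injective; +-suc; +-identityʳ; <-irrefl)
open import Data.Product using (Σ; ∃; _×_; _,_; proj₁; proj₂; map₁; swap)
open import Data.Sum using (_⊎_; inj₁; inj₂; [_,_])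
open import Data.Unit using (tt)
open import Function using (id; _∘_; _∘′_)
open import Function.Bundles using (Equivalence; mk⇔)
import Relation.Binary.PropositionalEquality as ≡
open import Relation.Binary.PropositionalEquality
  using (_≡_; _≢_; refl; cong; cong₂; subst; subst₂; sym; trans; module ≡-Reasoning)
open import Relation.Nullary using (¬_; yes; no; ¬?)
open import Relation.Nullary.Decidable using (_×-dec_; _⊎-dec_; decidable-stable)
open import Relation.Unary using (Decidable)

module Walks {n : ℕ} (G : Graph n) where

  open import Data.List.Membership.DecPropositional (_≟_ {n}) using (_∈?_)

  Adj : Fin n → Fin n → Set
  Adj u v = T (adj G u v)

  private variable
    a b c b₁ b₂ b₃ r u v w x y : Fin n

  adj-sym : Adj u v → Adj v u
  adj-sym {u} {v} = subst T (Graph.sym G u v)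

  adj⇒≢ : Adj u v → u ≢ v
  adj⇒≢ {u} e refl = subst T (irrefl G u) e

  vertices : Walk G u v → List (Fin n)
  vertices {u} here       = u ∷ []
  vertices {u} (step _ p) = u ∷ vertices p

  source∈ : (p : Walk G u v) → u ∈ vertices p
  source∈ here       = here refl
  source∈ (step _ _) = here refl

  _++ʷ_ : Walk G u v → Walk G v w → Walk G u w
  here     ++ʷ q = q
  step e p ++ʷ q = step e (p ++ʷ q)

  vertices-++ʷ : (p : Walk G u v) (q : Walk G v w) → vertices (p ++ʷ q) ⊆ vertices p ++ vertices q
  vertices-++ʷ here       q m         = there m
  vertices-++ʷ (step e p) q (here eq) = here eq
  vertices-++ʷ (step e p) q (there m) = there (vertices-++ʷ p q m)

  reverse : Walk G u v → Walk G v u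
  reverse here       = here
  reverse (step e p) = reverse p ++ʷ step (adj-sym e) here

  vertices-reverse : (p : Walk G u v) → vertices (reverse p) ⊆ vertices p
  vertices-reverse here m = m
  vertices-reverse (step e p) m with ∈-++⁻ (vertices (reverse p)) (vertices-++ʷ (reverse p) _ m)
  ... | inj₁ m′                = there (vertices-reverse p m′)
  ... | inj₂ (here refl)       = there (source∈ p)
  ... | inj₂ (there (here eq)) = here eq

  suffix : (p : Walk G x v) → u ∈ vertices p → Walk G u v
  suffix here       (here refl) = here
  suffix (step e p) (here refl) = step e p
  suffix (step e p) (there m)   = suffix p m

  suffix-⊆ : (p : Walk G x v) (m : u ∈ vertices p) → vertices (suffix p m) ⊆ vertices p
  suffix-⊆ here       (here refl) = id
  suffix-⊆ (step e p) (here refl) = id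
  suffix-⊆ (step e p) (there m)   = there ∘′ suffix-⊆ p m

  suffix-unique : (p : Walk G x v) (m : u ∈ vertices p) → Unique (vertices p) → Unique (vertices (suffix p m))
  suffix-unique here       (here refl) up       = up
  suffix-unique (step e p) (here refl) up       = up
  suffix-unique (step e p) (there m)   (_ ∷ up) = suffix-unique p m up

  record SimpleSubwalk (p : Walk G u v) : Set where
    field
      walk   : Walk G u v
      simple : Unique (vertices walk)
      ⊆-p    : vertices walk ⊆ vertices p

  simplify : (p : Walk G u v) → SimpleSubwalk p
  simplify here = record { walk = here ; simple = [] ∷ [] ; ⊆-p = id }
  simplify {u} (step e p) with simplify p
  ... | record { walk = q ; simple = sq ; ⊆-p = q⊆p } with u ∈? vertices q
  ...   | yes u∈q = record
    { walk   = suffix q u∈q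
    ; simple = suffix-unique q u∈q sq
    ; ⊆-p    = λ m → there (q⊆p (suffix-⊆ q u∈q m)) }
  ...   | no u∉q = record
    { walk   = step e q
    ; simple = ¬Any⇒All¬ _ u∉q ∷ sq
    ; ⊆-p    = λ { (here eq) → here eq ; (there m) → there (q⊆p m) } }

  walkLength : Walk G u v → ℕ
  walkLength here       = 0
  walkLength (step _ p) = suc (walkLength p)

  vertexAt : (p : Walk G u v) → Fin (suc (walkLength p)) → Fin n
  vertexAt {u} p          zero    = u
  vertexAt     (step _ p) (suc i) = vertexAt p i

  vertexAt-last : (p : Walk G u v) → vertexAt p (fromℕ (walkLength p)) ≡ v
  vertexAt-last here       = refl
  vertexAt-last (step _ p) = vertexAt-last p

  vertexAt-adjacent : (p : Walk G u v) (i : Fin (walkLength p)) →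
    Adj (vertexAt p (inject₁ i)) (vertexAt p (suc i))
  vertexAt-adjacent (step e p) zero    = e
  vertexAt-adjacent (step e p) (suc i) = vertexAt-adjacent p i

  vertexAt∈ : (p : Walk G u v) (i : Fin (suc (walkLength p))) → vertexAt p i ∈ vertices p
  vertexAt∈ p          zero    = source∈ p
  vertexAt∈ (step e p) (suc i) = there (vertexAt∈ p i)

  vertexAt-injective : (p : Walk G u v) → Unique (vertices p) →
    ∀ i j → vertexAt p i ≡ vertexAt p j → i ≡ j
  vertexAt-injective p          _         zero    zero    _  = refl
  vertexAt-injective (step e p) (u∉ ∷ _)  zero    (suc j) eq = ⊥-elim (All.lookup u∉ (vertexAt∈ p j) eq)
  vertexAt-injective (step e p) (u∉ ∷ _)  (suc i) zero    eq = ⊥-elim (All.lookup u∉ (vertexAt∈ p i) (sym eq))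
  vertexAt-injective (step e p) (_ ∷ up)  (suc i) (suc j) eq = cong suc (vertexAt-injective p up i j eq)

  closeCycle : (e : Adj u y) (p : Walk G y v) → y ≢ v → Adj v u → Unique (vertices (step e p)) → Cycle G
  closeCycle {u} e p y≢v vu simple = record
    { len-2    = suc (walkLength p)
    ; long     = s≤s (nonempty p y≢v)
    ; vert     = vertexAt (step e p)
    ; distinct = vertexAt-injective (step e p) simple
    ; consec   = vertexAt-adjacent (step e p)
    ; closing  = subst (λ z → Adj z u) (sym (vertexAt-last p)) vu }
    where
    nonempty : (q : Walk G y v) → y ≢ v → 1 ≤ walkLength q
    nonempty here       y≢v = ⊥-elim (y≢v refl)
    nonempty (step _ _) _   = s≤s z≤n

  closeCycle-edgesAtStart : (e : Adj u y) (p : Walk G y v) (y≢v : y ≢ v) (vu : Adj v u)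
    (simple : Unique (vertices (step e p))) →
    CycleEdge G (closeCycle e p y≢v vu simple) u x → x ≡ y ⊎ x ≡ v
  closeCycle-edgesAtStart e p _ _ _      (inj₁ (zero , inj₁ (_ , x≡y))) = inj₁ x≡y
  closeCycle-edgesAtStart e p _ _ simple (inj₁ (suc i , inj₁ (u≡ , _)))
    with vertexAt-injective (step e p) simple zero (suc (inject₁ i)) u≡
  ... | ()
  closeCycle-edgesAtStart e p _ _ simple (inj₁ (i , inj₂ (u≡ , _)))
    with vertexAt-injective (step e p) simple zero (suc i) u≡
  ... | ()
  closeCycle-edgesAtStart e p _ _ simple (inj₂ (inj₁ (u≡ , _)))
    with vertexAt-injective (step e p) simple zero (fromℕ _) u≡
  ... | ()
  closeCycle-edgesAtStart e p _ _ _      (inj₂ (inj₂ (_ , x≡))) = inj₂ (trans x≡ (vertexAt-last p))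

  record CycleThrough (a b c : Fin n) : Set where
    field
      cycle      : Cycle G
      edge-ab    : CycleEdge G cycle a b
      on-a       : OnCycle G cycle a
      on-c       : OnCycle G cycle c
      edges-at-a : ∀ {x} → CycleEdge G cycle a x → x ≡ b ⊎ x ≡ c

  cycleThrough : Adj a b → Adj a c → b ≢ c → (p : Walk G b c) → a ∉ vertices p → CycleThrough a b c
  cycleThrough ab ac b≢c p a∉p = record
    { cycle      = closeCycle ab q b≢c (adj-sym ac) simple′
    ; edge-ab    = inj₁ (zero , inj₁ (refl , refl))
    ; on-a       = zero , refl
    ; on-c       = fromℕ _ , vertexAt-last q
    ; edges-at-a = closeCycle-edgesAtStart ab q b≢c (adj-sym ac) simple′ }
    where
    open SimpleSubwalk (simplify p) renaming (walk to q)
    simple′ : Unique (vertices (step ab q))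
    simple′ = ¬Any⇒All¬ _ (a∉p ∘′ ⊆-p) ∷ simple

  avoids-++ʷ-reverse : (p : Walk G u r) (q : Walk G v r) → a ∉ vertices p → a ∉ vertices q →
    a ∉ vertices (p ++ʷ reverse q)
  avoids-++ʷ-reverse p q a∉p a∉q m =
    [ a∉p , a∉q ∘′ vertices-reverse q ] (∈-++⁻ (vertices p) (vertices-++ʷ p (reverse q) m))

  -- b₁ ⋯ r ⋯ b₂ and b₃ ⋯ r ⋯ b₂ close two different cycles through the edge a b₂, which a cactus forbids.
  cactus-noTheta : Cactus G → Adj a b₁ → Adj a b₂ → Adj a b₃ → b₁ ≢ b₂ → b₁ ≢ b₃ → b₂ ≢ b₃ →
    (p₁ : Walk G b₁ r) (p₂ : Walk G b₂ r) (p₃ : Walk G b₃ r) →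
    a ∉ vertices p₁ → a ∉ vertices p₂ → a ∉ vertices p₃ → ⊥
  cactus-noTheta (_ , shareOne) e₁ e₂ e₃ b₁≢b₂ b₁≢b₃ b₂≢b₃ p₁ p₂ p₃ a∉₁ a∉₂ a∉₃ =
    adj⇒≢ e₂ (shareOne C₁.cycle C₂.cycle different _ _ C₁.on-a C₂.on-a C₁.on-c C₂.on-c)
    where
    module C₁ = CycleThrough (cycleThrough e₁ e₂ b₁≢b₂ (p₁ ++ʷ reverse p₂) (avoids-++ʷ-reverse p₁ p₂ a∉₁ a∉₂))
    module C₂ = CycleThrough (cycleThrough e₃ e₂ (b₂≢b₃ ∘′ sym) (p₃ ++ʷ reverse p₂) (avoids-++ʷ-reverse p₃ p₂ a∉₃ a∉₂))
    different : DistinctCycles G C₁.cycle C₂.cycle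
    different same with C₁.edges-at-a (Equivalence.from (same _ _) C₂.edge-ab)
    ... | inj₁ b₃≡b₁ = b₁≢b₃ (sym b₃≡b₁)
    ... | inj₂ b₃≡b₂ = b₂≢b₃ (sym b₃≡b₂)

module _ {A : Set} where

  indicator : (A → Bool) → A → ℕ
  indicator p x = if p x then 1 else 0

  tally : (A → Bool) → List A → ℕ
  tally p xs = sum (map (indicator p) xs)

  tally≡length-filter : ∀ p xs → tally p xs ≡ length (filter (T? ∘ p) xs)
  tally≡length-filter p []       = refl
  tally≡length-filter p (x ∷ xs) with p x
  ... | true  = cong suc (tally≡length-filter p xs)
  ... | false = tally≡length-filter p xs

  tally-++ : ∀ p xs ys → tally p (xs ++ ys) ≡ tally p xs + tally p ys
  tally-++ p xs ys = trans (cong sum (List.map-++ (indicator p) xs ys)) (sum-++ (map (indicator p) xs) _)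

  tally-↭ : ∀ p {xs ys} → xs ↭ ys → tally p xs ≡ tally p ys
  tally-↭ p xs↭ys = sum-↭ (↭.map⁺ (indicator p) xs↭ys)

  tally-suc⇒∃ : ∀ p xs {k} → tally p xs ≡ suc k → ∃ (T ∘ p)
  tally-suc⇒∃ p (x ∷ xs) eq with p x in px
  ... | true  = x , subst T (sym px) tt
  ... | false = tally-suc⇒∃ p xs eq

  Unique-resp-↭ : ∀ {xs ys : List A} → xs ↭ ys → Unique xs → Unique ys
  Unique-resp-↭ xs↭ys = ↭ₛ.Unique-resp-↭ (≡.setoid A) (↭⇒↭ₛ xs↭ys)

  insertAfterFirst : (A → Bool) → List A → List A → List A
  insertAfterFirst p ys []       = ys
  insertAfterFirst p ys (x ∷ xs) with p x
  ... | true  = x ∷ ys ++ xs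
  ... | false = x ∷ insertAfterFirst p ys xs

  insertAfterFirst-↭ : ∀ p ys xs → insertAfterFirst p ys xs ↭ ys ++ xs
  insertAfterFirst-↭ p ys []       = ↭-sym (++-identityʳ ys)
  insertAfterFirst-↭ p ys (x ∷ xs) with p x
  ... | true  = ↭-sym (shift x ys xs)
  ... | false = ↭-trans (prep x (insertAfterFirst-↭ p ys xs)) (↭-sym (shift x ys xs))

  insertAround : (A → Bool) → List A → List A → List A → List A → List A
  insertAround p xs ys zs L = xs ++ insertAfterFirst p ys L ++ zs

  insertAround-↭ : ∀ p xs ys zs L → insertAround p xs ys zs L ↭ (xs ++ ys ++ zs) ++ L
  insertAround-↭ p xs ys zs L = begin
    xs ++ insertAfterFirst p ys L ++ zs ↭⟨ ++⁺ˡ xs (++⁺ʳ zs (insertAfterFirst-↭ p ys L)) ⟩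
    xs ++ (ys ++ L) ++ zs               ≡⟨ cong (xs ++_) (List.++-assoc ys L zs) ⟩
    xs ++ ys ++ L ++ zs                 ↭⟨ ++⁺ˡ xs (++⁺ˡ ys (++-comm L zs)) ⟩
    xs ++ ys ++ zs ++ L                 ≡⟨ cong (xs ++_) (sym (List.++-assoc ys zs L)) ⟩
    xs ++ (ys ++ zs) ++ L               ≡⟨ sym (List.++-assoc xs (ys ++ zs) L) ⟩
    (xs ++ ys ++ zs) ++ L               ∎
    where open PermutationReasoning

  interleave : List A → List A → List A
  interleave []       ys = ys
  interleave (x ∷ xs) ys = x ∷ interleave ys xs

  interleave-↭ : ∀ xs ys → interleave xs ys ↭ xs ++ ys
  interleave-↭ []       ys = ↭-refl
  interleave-↭ (x ∷ xs) ys = prep x (↭-trans (interleave-↭ ys xs) (++-comm ys xs))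

  Unique⇒length≤2 : ∀ {P : A → Set} {xs} → Unique xs → (∀ {x} → x ∈ xs → P x) →
    (∀ {x y z} → P x → P y → P z → x ≢ y → x ≢ z → y ≢ z → ⊥) → length xs ≤ 2
  Unique⇒length≤2 {xs = []}          _ _ _ = z≤n
  Unique⇒length≤2 {xs = _ ∷ []}      _ _ _ = s≤s z≤n
  Unique⇒length≤2 {xs = _ ∷ _ ∷ []}  _ _ _ = s≤s (s≤s z≤n)
  Unique⇒length≤2 {xs = _ ∷ _ ∷ _ ∷ _} ((x≢y ∷ x≢z ∷ _) ∷ (y≢z ∷ _) ∷ _) P∈ noTriple =
    ⊥-elim (noTriple (P∈ (here refl)) (P∈ (there (here refl))) (P∈ (there (there (here refl)))) x≢y x≢z y≢z)

module _ {n : ℕ} where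

  open import Data.List.Membership.DecPropositional (_≟_ {n}) using (_∈?_; _∉?_)

  complement : List (Fin n) → List (Fin n)
  complement xs = filter (_∉? xs) (allFin n)

  allFin-↭ : ∀ {xs} → Unique xs → allFin n ↭ xs ++ complement xs
  allFin-↭ {xs} uxs = ∼bag⇒↭ (unique∧set⇒bag (Unique.allFin⁺ n) (Unique.++⁺ uxs (Unique.filter⁺ _ (Unique.allFin⁺ n)) disjoint)
    (λ {x} → mk⇔ (λ _ → split x) (λ _ → ∈-allFin x)))
    where
    disjoint : Disjoint xs (complement xs)
    disjoint (x∈xs , x∈c) = proj₂ (∈-filter⁻ (_∉? xs) {xs = allFin n} x∈c) x∈xs
    split : ∀ x → x ∈ xs ++ complement xs
    split x with x ∈? xs
    ... | yes x∈xs = ∈-++⁺ˡ x∈xs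
    ... | no  x∉xs = ∈-++⁺ʳ xs (∈-filter⁺ (_∉? xs) (∈-allFin x) x∉xs)

  Unique⇒length≤ : ∀ {xs : List (Fin n)} → Unique xs → length xs ≤ n
  Unique⇒length≤ {xs} uxs = subst (length xs ≤_)
    (trans (sym (List.length-++ xs)) (trans (sym (↭-length (allFin-↭ uxs))) (List.length-tabulate id)))
    (m≤m+n (length xs) _)

module Alternation {n : ℕ} (G : Graph n) {A : Set} (κ : A → Colour) where

  Blue Red : A → Set
  Blue x = κ x ≡ blue
  Red  x = κ x ≡ red

  private variable
    bs rs : List A

  interleave-alternating : All Blue bs → All Red rs → length bs ≡ suc (length rs) →
    AltBlue G (map κ (interleave bs rs))
  blue∷interleave-alternating : All Blue bs → All Red rs → length bs ≡ length rs →
    AltBlue G (blue ∷ map κ (interleave rs bs))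

  interleave-alternating (b-blue ∷ bs-blue) rs-red eq rewrite b-blue =
    blue∷interleave-alternating bs-blue rs-red (suc-injective eq)

  blue∷interleave-alternating {[]} {[]} [] [] refl = single
  blue∷interleave-alternating bs-blue (r-red ∷ rs-red) eq rewrite r-red =
    more (interleave-alternating bs-blue rs-red eq)

  -- insertAround (λ _ → true) xs ys zs w puts ys between the two letters of w.
  record Arrangement (w : List Colour) (bs rs : List A) : Set where
    field
      before between after : List A
      ↭bs++rs     : before ++ between ++ after ↭ bs ++ rs
      alternating : AltBlue G (insertAround (λ _ → true) (map κ before) (map κ between) (map κ after) w)

  arrange : ∀ w {bs rs} → All Blue bs → All Red rs → length w ≤ 2 →
    tally isBlue w + length bs ≡ suc (tally isRed w + length rs) → Arrangement w bs rs
  arrange [] {bs} {rs} bs-blue rs-red _ eq = record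
    { before = [] ; between = [] ; after = interleave bs rs
    ; ↭bs++rs = interleave-↭ bs rs
    ; alternating = interleave-alternating bs-blue rs-red eq }
  arrange (blue ∷ []) {bs} {rs} bs-blue rs-red _ eq = record
    { before = [] ; between = [] ; after = interleave rs bs
    ; ↭bs++rs = ↭-trans (interleave-↭ rs bs) (++-comm rs bs)
    ; alternating = blue∷interleave-alternating bs-blue rs-red (suc-injective eq) }
  arrange (red ∷ []) {b ∷ bs} {rs} (b-blue ∷ bs-blue) rs-red _ eq = record
    { before = b ∷ [] ; between = [] ; after = interleave bs rs
    ; ↭bs++rs = prep b (interleave-↭ bs rs)
    ; alternating = subst (λ c → AltBlue G (c ∷ red ∷ map κ (interleave bs rs))) (sym b-blue)
        (more (interleave-alternating bs-blue rs-red (suc-injective eq))) }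
  arrange (blue ∷ blue ∷ []) {bs} {r ∷ rs} bs-blue (r-red ∷ rs-red) _ eq = record
    { before = [] ; between = r ∷ [] ; after = interleave rs bs
    ; ↭bs++rs = ↭-trans (prep r (↭-trans (interleave-↭ rs bs) (++-comm rs bs))) (↭-sym (shift r bs rs))
    ; alternating = subst (λ c → AltBlue G (blue ∷ c ∷ blue ∷ map κ (interleave rs bs))) (sym r-red)
        (more (blue∷interleave-alternating bs-blue rs-red (suc-injective (suc-injective eq)))) }
  arrange (blue ∷ red ∷ []) {bs} {rs} bs-blue rs-red _ eq = record
    { before = [] ; between = [] ; after = interleave bs rs
    ; ↭bs++rs = interleave-↭ bs rs
    ; alternating = more (interleave-alternating bs-blue rs-red (suc-injective eq)) }
  arrange (red ∷ blue ∷ []) {b ∷ bs} {rs} (b-blue ∷ bs-blue) rs-red _ eq = record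
    { before = b ∷ [] ; between = [] ; after = interleave rs bs
    ; ↭bs++rs = prep b (↭-trans (interleave-↭ rs bs) (++-comm rs bs))
    ; alternating = subst (λ c → AltBlue G (c ∷ red ∷ blue ∷ map κ (interleave rs bs))) (sym b-blue)
        (more (blue∷interleave-alternating bs-blue rs-red (suc-injective (suc-injective eq)))) }
  arrange (red ∷ red ∷ []) {b₀ ∷ b₁ ∷ bs} {rs} (b₀-blue ∷ b₁-blue ∷ bs-blue) rs-red _ eq = record
    { before = b₀ ∷ [] ; between = b₁ ∷ [] ; after = interleave bs rs
    ; ↭bs++rs = prep b₀ (prep b₁ (interleave-↭ bs rs))
    ; alternating = subst₂ (λ c c′ → AltBlue G (c ∷ red ∷ c′ ∷ red ∷ map κ (interleave bs rs))) (sym b₀-blue) (sym b₁-blue)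
        (more (more (interleave-alternating bs-blue rs-red (suc-injective (suc-injective eq))))) }
  arrange (red ∷ [])          {[]}         _ _ _ ()
  arrange (red ∷ blue ∷ [])   {[]}         _ _ _ ()
  arrange (red ∷ red ∷ [])    {[]}         _ _ _ ()
  arrange (red ∷ red ∷ [])    {_ ∷ []}     _ _ _ ()
  arrange (blue ∷ blue ∷ [])  {_} {[]}     _ _ _ ()
  arrange (_ ∷ _ ∷ _ ∷ _) _ _ (s≤s (s≤s ())) _

T-if⁻ : ∀ b {x} → T (if b then x else false) → T b × T x
T-if⁻ true tx = tt , tx

T-if⁺ : ∀ b {x} → T b → T x → T (if b then x else false)
T-if⁺ true _ tx = tx

isBlue-T : ∀ c → T (isBlue c) → c ≡ blue
isBlue-T blue _ = refl

isRed-T : ∀ c → T (isRed c) → c ≡ red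
isRed-T red _ = refl

module Colours {n : ℕ} (G : Graph n) (col : Fin n → Fin n → Colour) (col-sym : ∀ u v → col u v ≡ col v u) where

  open Walks G
  open import Data.List.Membership.DecPropositional (_≟_ {n}) using (_∉?_)

  χ : Colouring G
  χ = col , col-sym

  colours : Fin n → List (Fin n) → List Colour
  colours = nbrColours G χ

  private variable
    a s v x : Fin n
    xs ys L : List (Fin n)

  colours-++ : ∀ s xs ys → colours s (xs ++ ys) ≡ colours s xs ++ colours s ys
  colours-++ s []       ys = refl
  colours-++ s (x ∷ xs) ys with adj G s x
  ... | true  = cong (col s x ∷_) (colours-++ s xs ys)
  ... | false = colours-++ s xs ys

  colours-∷ : ∀ s x xs ys → colours s xs ≡ colours s ys → colours s (x ∷ xs) ≡ colours s (x ∷ ys)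
  colours-∷ s x _ _ eq with adj G s x
  ... | true  = cong (col s x ∷_) eq
  ... | false = eq

  colours-nonadjacent : All (¬_ ∘ Adj s) xs → colours s xs ≡ []
  colours-nonadjacent []                      = refl
  colours-nonadjacent {s} {x ∷ _} (¬sx ∷ ¬sxs) with adj G s x
  ... | true  = ⊥-elim (¬sx tt)
  ... | false = colours-nonadjacent ¬sxs

  colours-adjacent : All (Adj s) xs → colours s xs ≡ map (col s) xs
  colours-adjacent []                     = refl
  colours-adjacent {s} {x ∷ _} (sx ∷ sxs) with adj G s x | sx
  ... | true | _ = cong (col s x ∷_) (colours-adjacent sxs)

  colours-insertAfterFirst : ∀ s ys xs →
    colours s (insertAfterFirst (adj G s) ys xs) ≡ insertAfterFirst (λ _ → true) (colours s ys) (colours s xs)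
  colours-insertAfterFirst s ys []       = refl
  colours-insertAfterFirst s ys (x ∷ xs) with adj G s x in sx
  ... | true  rewrite sx = cong (col s x ∷_) (colours-++ s ys xs)
  ... | false rewrite sx = colours-insertAfterFirst s ys xs

  colours-insertAfterFirst-invisible : ∀ p xs → colours s ys ≡ [] →
    colours s (insertAfterFirst p ys xs) ≡ colours s xs
  colours-insertAfterFirst-invisible p []       none = none
  colours-insertAfterFirst-invisible {s} {ys} p (x ∷ xs) none with p x
  ... | true  = colours-∷ s x (ys ++ xs) xs (trans (colours-++ s ys xs) (cong (_++ colours s xs) none))
  ... | false = colours-∷ s x (insertAfterFirst p ys xs) xs (colours-insertAfterFirst-invisible {ys = ys} p xs none)

  colours-insertAround : ∀ s p xs ys zs L →
    colours s (insertAround p xs ys zs L) ≡ colours s xs ++ colours s (insertAfterFirst p ys L) ++ colours s zs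
  colours-insertAround s p xs ys zs L =
    trans (colours-++ s xs _) (cong (colours s xs ++_) (colours-++ s (insertAfterFirst p ys L) zs))

  colours-insertAround-adjacent : ∀ xs ys zs L → All (Adj s) (xs ++ ys ++ zs) →
    colours s (insertAround (adj G s) xs ys zs L) ≡
    insertAround (λ _ → true) (map (col s) xs) (map (col s) ys) (map (col s) zs) (colours s L)
  colours-insertAround-adjacent {s} xs ys zs L adjacent = begin
    colours s (insertAround (adj G s) xs ys zs L)
      ≡⟨ colours-insertAround s (adj G s) xs ys zs L ⟩
    colours s xs ++ colours s (insertAfterFirst (adj G s) ys L) ++ colours s zs
      ≡⟨ cong (λ w → colours s xs ++ w ++ colours s zs) (colours-insertAfterFirst s ys L) ⟩
    colours s xs ++ insertAfterFirst (λ _ → true) (colours s ys) (colours s L) ++ colours s zs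
      ≡⟨ cong₂ (λ w w′ → w ++ insertAfterFirst (λ _ → true) w′ (colours s L) ++ colours s zs)
               (colours-adjacent (++⁻ˡ xs adjacent)) (colours-adjacent (++⁻ˡ ys (++⁻ʳ xs adjacent))) ⟩
    map (col s) xs ++ insertAfterFirst (λ _ → true) (map (col s) ys) (colours s L) ++ colours s zs
      ≡⟨ cong (λ w → map (col s) xs ++ insertAfterFirst (λ _ → true) (map (col s) ys) (colours s L) ++ w)
              (colours-adjacent (++⁻ʳ ys (++⁻ʳ xs adjacent))) ⟩
    insertAround (λ _ → true) (map (col s) xs) (map (col s) ys) (map (col s) zs) (colours s L) ∎
    where open ≡-Reasoning

  colours-insertAround-invisible : ∀ p xs ys zs L → All (¬_ ∘ Adj s) (xs ++ ys ++ zs) →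
    colours s (insertAround p xs ys zs L) ≡ colours s L
  colours-insertAround-invisible {s} p xs ys zs L invisible = begin
    colours s (insertAround p xs ys zs L)
      ≡⟨ colours-insertAround s p xs ys zs L ⟩
    colours s xs ++ colours s (insertAfterFirst p ys L) ++ colours s zs
      ≡⟨ cong₂ (λ w w′ → w ++ colours s (insertAfterFirst p ys L) ++ w′)
               (colours-nonadjacent (++⁻ˡ xs invisible)) (colours-nonadjacent (++⁻ʳ ys (++⁻ʳ xs invisible))) ⟩
    colours s (insertAfterFirst p ys L) ++ []
      ≡⟨ List.++-identityʳ _ ⟩
    colours s (insertAfterFirst p ys L)
      ≡⟨ colours-insertAfterFirst-invisible p L (colours-nonadjacent (++⁻ˡ ys (++⁻ʳ xs invisible))) ⟩
    colours s L ∎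
    where open ≡-Reasoning

  length-colours : ∀ s xs → length (colours s xs) ≡ length (filter (T? ∘ adj G s) xs)
  length-colours s []       = refl
  length-colours s (x ∷ xs) with adj G s x
  ... | true  = cong suc (length-colours s xs)
  ... | false = length-colours s xs

  -- degB G χ a and degR G χ a unfold to tally (nbrOfColour isBlue a) (allFin n) and its red analogue.
  nbrOfColour : (Colour → Bool) → Fin n → Fin n → Bool
  nbrOfColour f a v = if adj G a v then f (col a v) else false

  tally-nbrOfColour : ∀ f a xs → tally (nbrOfColour f a) xs ≡ tally f (colours a xs)
  tally-nbrOfColour f a []       = refl
  tally-nbrOfColour f a (x ∷ xs) with adj G a x
  ... | true  = cong (indicator f (col a x) +_) (tally-nbrOfColour f a xs)
  ... | false = tally-nbrOfColour f a xs

  freshNbrs : (Colour → Bool) → Fin n → List (Fin n) → List (Fin n)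
  freshNbrs f a L = filter (T? ∘ nbrOfColour f a) (complement L)

  ∈-freshNbrs⁻ : ∀ f → v ∈ freshNbrs f a L → (Adj a v × T (f (col a v))) × v ∉ L
  ∈-freshNbrs⁻ {v} {a} {L} f m with ∈-filter⁻ (T? ∘ nbrOfColour f a) {xs = complement L} m
  ... | v∈c , fv = T-if⁻ (adj G a v) fv , proj₂ (∈-filter⁻ (_∉? L) {xs = allFin n} v∈c)

  ∈-freshNbrs⁺ : ∀ f → Adj a v → T (f (col a v)) → v ∉ L → v ∈ freshNbrs f a L
  ∈-freshNbrs⁺ {a} {v} {L} f av fv v∉L =
    ∈-filter⁺ (T? ∘ nbrOfColour f a) (∈-filter⁺ (_∉? L) (∈-allFin v) v∉L) (T-if⁺ (adj G a v) av fv)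

  outsideNbrs : Fin n → List (Fin n) → List (Fin n)
  outsideNbrs a L = freshNbrs isBlue a L ++ freshNbrs isRed a L

  ∈-outsideNbrs⁻ : ∀ a L → v ∈ outsideNbrs a L → Adj a v × v ∉ L
  ∈-outsideNbrs⁻ a L m with ∈-++⁻ (freshNbrs isBlue a L) m
  ... | inj₁ m′ = map₁ proj₁ (∈-freshNbrs⁻ isBlue m′)
  ... | inj₂ m′ = map₁ proj₁ (∈-freshNbrs⁻ isRed m′)

  ∈-outsideNbrs⁺ : Adj a v → v ∉ L → v ∈ outsideNbrs a L
  ∈-outsideNbrs⁺ {a} {v} av v∉L with col a v in c
  ... | blue = ∈-++⁺ˡ (∈-freshNbrs⁺ isBlue av (subst (T ∘ isBlue) (sym c) tt) v∉L)
  ... | red  = ∈-++⁺ʳ _ (∈-freshNbrs⁺ isRed av (subst (T ∘ isRed) (sym c) tt) v∉L)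

  outsideNbrs++-unique : ∀ a → Unique L → Unique (outsideNbrs a L ++ L)
  outsideNbrs++-unique {L} a uL = Unique.++⁺
    (Unique.++⁺ (freshNbrs-unique isBlue) (freshNbrs-unique isRed) blue#red) uL
    (λ (m , m′) → proj₂ (∈-outsideNbrs⁻ a L m) m′)
    where
    freshNbrs-unique : ∀ f → Unique (freshNbrs f a L)
    freshNbrs-unique f = Unique.filter⁺ _ (Unique.filter⁺ _ (Unique.allFin⁺ n))
    blue#red : Disjoint (freshNbrs isBlue a L) (freshNbrs isRed a L)
    blue#red (mb , mr) with trans (sym (isBlue-T _ (proj₂ (proj₁ (∈-freshNbrs⁻ isBlue mb)))))
                                  (isRed-T _ (proj₂ (proj₁ (∈-freshNbrs⁻ isRed mr))))
    ... | ()

  degree-split : ∀ f a → Unique L →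
    tally (nbrOfColour f a) (allFin n) ≡ tally f (colours a L) + length (freshNbrs f a L)
  degree-split {L} f a uL = begin
    tally p (allFin n)                     ≡⟨ tally-↭ p (allFin-↭ uL) ⟩
    tally p (L ++ complement L)            ≡⟨ tally-++ p L (complement L) ⟩
    tally p L + tally p (complement L)     ≡⟨ cong₂ _+_ (tally-nbrOfColour f a L) (tally≡length-filter p (complement L)) ⟩
    tally f (colours a L) + length (freshNbrs f a L) ∎
    where
    p : Fin n → Bool
    p = nbrOfColour f a
    open ≡-Reasoning

  record Extension (a : Fin n) (L : List (Fin n)) : Set where
    field
      new L′       : List (Fin n)
      L′↭new++L    : L′ ↭ new ++ L
      unique       : Unique L′
      new-fresh    : ∀ {v} → v ∈ new → Adj a v × v ∉ L
      new-complete : ∀ {v} → Adj a v → v ∉ L → v ∈ new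
      alternating  : AltBlue G (colours a L′)
      stable       : ∀ {s} → (∀ {v} → v ∈ new → ¬ Adj s v) → colours s L′ ≡ colours s L

  extend : Unique L → degB G χ a ≡ suc (degR G χ a) → length (colours a L) ≤ 2 → Extension a L
  extend {L} {a} uL balanced few = record
    { new          = new
    ; L′           = insertAround (adj G a) before between after L
    ; L′↭new++L    = L′↭new++L
    ; unique       = Unique-resp-↭ (↭-sym L′↭new++L)
                       (Unique-resp-↭ (↭-sym (++⁺ʳ L ↭bs++rs)) (outsideNbrs++-unique a uL))
    ; new-fresh    = new-fresh
    ; new-complete = λ av v∉L → ∈-resp-↭ (↭-sym ↭bs++rs) (∈-outsideNbrs⁺ av v∉L)
    ; alternating  = subst (AltBlue G)
                       (sym (colours-insertAround-adjacent before between after L (All.tabulate (proj₁ ∘′ new-fresh))))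
                       arranged
    ; stable       = λ invisible → colours-insertAround-invisible (adj G a) before between after L (All.tabulate invisible) }
    where
    balance : tally isBlue (colours a L) + length (freshNbrs isBlue a L) ≡
              suc (tally isRed (colours a L) + length (freshNbrs isRed a L))
    balance = trans (sym (degree-split isBlue a uL)) (trans balanced (cong suc (degree-split isRed a uL)))

    open Alternation G (col a)
    open Arrangement (arrange (colours a L)
      (All.tabulate (λ m → isBlue-T _ (proj₂ (proj₁ (∈-freshNbrs⁻ isBlue m)))))
      (All.tabulate (λ m → isRed-T _ (proj₂ (proj₁ (∈-freshNbrs⁻ isRed m)))))
      few balance)
      renaming (alternating to arranged)

    new : List (Fin n)
    new = before ++ between ++ after

    L′↭new++L : insertAround (adj G a) before between after L ↭ new ++ L
    L′↭new++L = insertAround-↭ (adj G a) before between after L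

    new-fresh : ∀ {v} → v ∈ new → Adj a v × v ∉ L
    new-fresh = ∈-outsideNbrs⁻ a L ∘′ ∈-resp-↭ ↭bs++rs

module Configuring {n : ℕ} (G : Graph n) (col : Fin n → Fin n → Colour) (col-sym : ∀ u v → col u v ≡ col v u)
  (cactus : Cactus G) (balanced : Difference1 G (col , col-sym))
  (side : Fin n → Bool) (bipartite : ∀ u v → T (adj G u v) → side u ≡ not (side v)) where

  open Walks G
  open Colours G col col-sym
  open import Data.List.Membership.DecPropositional (_≟_ {n}) using (_∈?_)

  private variable
    u v x z : Fin n

  opposite : Adj u v → side v ≡ not (side u)
  opposite {u} {v} uv = sym (trans (cong not (bipartite u v uv)) (not-involutive (side v)))

  sameSide⇒¬Adj : side u ≡ side v → ¬ Adj u v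
  sameSide⇒¬Adj {u} {v} same uv = not-¬ same (bipartite u v uv)

  record SideOrder (t : Bool) : Set where
    field
      order       : List (Fin n)
      unique      : Unique order
      other-side  : ∀ {x} → x ∈ order → side x ≡ not t
      covers      : ∀ {u} → side u ≡ t → ∀ {v} → Adj u v → v ∈ order
      alternating : ∀ {u} → side u ≡ t → AltBlue G (colours u order)

  module Build (t : Bool) (root : Fin n) (root-side : side root ≡ t) where

    record Stage : Set where
      field
        done order   : List (Fin n)
        done-unique  : Unique done
        order-unique : Unique order
        other-side   : ∀ {x} → x ∈ order → side x ≡ not t
        covered      : ∀ {s} → s ∈ done → ∀ {v} → Adj s v → v ∈ order
        alternating  : ∀ {s} → s ∈ done → AltBlue G (colours s order)
        linked       : ∀ {x} → x ∈ order → Σ (Walk G x root) λ p → vertices p ⊆ order ++ done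

    initial : Stage
    initial = record
      { done = [] ; order = [] ; done-unique = [] ; order-unique = []
      ; other-side = λ () ; covered = λ () ; alternating = λ () ; linked = λ () }

    Next : Stage → Fin n → Set
    Next st a = side a ≡ t × a ∉ done × (a ≡ root ⊎ Any (Adj a) order)
      where open Stage st

    next? : ∀ st → Decidable (Next st)
    next? st a = side a Bool.≟ t ×-dec ¬? (a ∈? done) ×-dec (a ≟ root ⊎-dec any? (T? ∘ adj G a) order)
      where open Stage st

    advance : (st : Stage) (a : Fin n) → Next st a → Stage
    advance st a (a-side , a∉done , a-reach) = record
      { done         = a ∷ done
      ; order        = E.L′
      ; done-unique  = ¬Any⇒All¬ done a∉done ∷ done-unique
      ; order-unique = E.unique
      ; other-side   = other-side′
      ; covered      = covered′
      ; alternating  = alternating′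
      ; linked       = linked′ }
      where
      open Stage st

      a∉order : a ∉ order
      a∉order = not-¬ a-side ∘′ other-side

      avoids-a : ∀ {b} (m : b ∈ order) → a ∉ vertices (proj₁ (linked m))
      avoids-a m a∈ = [ a∉order , a∉done ] (∈-++⁻ order (proj₂ (linked m) a∈))

      few : length (colours a order) ≤ 2
      few = subst (_≤ 2) (sym (length-colours a order))
        (Unique⇒length≤2 (Unique.filter⁺ _ order-unique) (swap ∘′ ∈-filter⁻ (T? ∘ adj G a)) noTheta)
        where
        noTheta : ∀ {b₁ b₂ b₃} → Adj a b₁ × b₁ ∈ order → Adj a b₂ × b₂ ∈ order → Adj a b₃ × b₃ ∈ order →
          b₁ ≢ b₂ → b₁ ≢ b₃ → b₂ ≢ b₃ → ⊥
        noTheta (e₁ , m₁) (e₂ , m₂) (e₃ , m₃) b₁≢b₂ b₁≢b₃ b₂≢b₃ =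
          cactus-noTheta cactus e₁ e₂ e₃ b₁≢b₂ b₁≢b₃ b₂≢b₃
            (proj₁ (linked m₁)) (proj₁ (linked m₂)) (proj₁ (linked m₃)) (avoids-a m₁) (avoids-a m₂) (avoids-a m₃)

      module E = Extension (extend order-unique (balanced a) few)

      order⊆L′ : order ⊆ E.L′
      order⊆L′ = ∈-resp-↭ (↭-sym E.L′↭new++L) ∘′ ∈-++⁺ʳ E.new

      new⊆L′ : E.new ⊆ E.L′
      new⊆L′ = ∈-resp-↭ (↭-sym E.L′↭new++L) ∘′ ∈-++⁺ˡ

      widen : order ++ done ⊆ E.L′ ++ a ∷ done
      widen = [ ∈-++⁺ˡ ∘′ order⊆L′ , ∈-++⁺ʳ E.L′ ∘′ there ] ∘′ ∈-++⁻ order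

      other-side′ : ∀ {x} → x ∈ E.L′ → side x ≡ not t
      other-side′ m with ∈-++⁻ E.new (∈-resp-↭ E.L′↭new++L m)
      ... | inj₁ m′ = trans (opposite (proj₁ (E.new-fresh m′))) (cong not a-side)
      ... | inj₂ m′ = other-side m′

      covered′ : ∀ {s} → s ∈ a ∷ done → ∀ {v} → Adj s v → v ∈ E.L′
      covered′ (here refl) {v} av with v ∈? order
      ... | yes v∈order = order⊆L′ v∈order
      ... | no  v∉order = new⊆L′ (E.new-complete av v∉order)
      covered′ (there s∈) sv = order⊆L′ (covered s∈ sv)

      alternating′ : ∀ {s} → s ∈ a ∷ done → AltBlue G (colours s E.L′)
      alternating′ (here refl) = E.alternating
      alternating′ (there s∈) =
        subst (AltBlue G) (sym (E.stable λ v∈new sv → proj₂ (E.new-fresh v∈new) (covered s∈ sv))) (alternating s∈)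

      link : a ≡ root ⊎ Any (Adj a) order → Σ (Walk G a root) λ p → vertices p ⊆ E.L′ ++ a ∷ done
      link (inj₁ refl) = here , λ { (here refl) → ∈-++⁺ʳ E.L′ (here refl) }
      link (inj₂ a~order) with find a~order
      ... | b , b∈ , ab = step ab (proj₁ (linked b∈)) ,
            λ { (here refl) → ∈-++⁺ʳ E.L′ (here refl) ; (there m) → widen (proj₂ (linked b∈) m) }

      a-linked : Σ (Walk G a root) λ p → vertices p ⊆ E.L′ ++ a ∷ done
      a-linked = link a-reach

      linked′ : ∀ {x} → x ∈ E.L′ → Σ (Walk G x root) λ p → vertices p ⊆ E.L′ ++ a ∷ done
      linked′ m with ∈-++⁻ E.new (∈-resp-↭ E.L′↭new++L m)
      ... | inj₁ m′ = step (adj-sym (proj₁ (E.new-fresh m′))) (proj₁ a-linked) ,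
                      λ { (here refl) → ∈-++⁺ˡ m ; (there k) → proj₂ a-linked k }
      ... | inj₂ m′ = proj₁ (linked m′) , widen ∘′ proj₂ (linked m′)

    -- Along a walk from the root, vertices of side t stay done and the others stay ordered.
    stuck⇒done : (st : Stage) → (∀ a → ¬ Next st a) → ∀ {u} → side u ≡ t → u ∈ Stage.done st
    stuck⇒done st stuck {u} u-side = proj₁ (along (proj₁ cactus root u) root-settled) u-side
      where
      open Stage st

      Settled : Fin n → Set
      Settled x = (side x ≡ t → x ∈ done) × (side x ≡ not t → x ∈ order)

      forced : side x ≡ t → x ≡ root ⊎ Any (Adj x) order → x ∈ done
      forced {x} x-side reach = decidable-stable (x ∈? done) (λ x∉ → stuck x (x-side , x∉ , reach))

      root-settled : Settled root
      root-settled = (λ _ → forced root-side (inj₁ refl)) , (λ r-side → ⊥-elim (not-¬ root-side r-side))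

      settled-step : Adj x z → Settled x → Settled z
      settled-step {x} {z} xz (x-done , x-order) =
        (λ z-side → forced z-side (inj₂ (lose (x-order (trans (bipartite x z xz) (cong not z-side))) (adj-sym xz)))) ,
        (λ z-side → covered (x-done (trans (bipartite x z xz) (trans (cong not z-side) (not-involutive t)))) xz)

      along : Walk G x z → Settled x → Settled z
      along here       settled = settled
      along (step e p) settled = along p (settled-step e settled)

    finish : (st : Stage) → (∀ a → ¬ Next st a) → SideOrder t
    finish st stuck = record
      { order       = order
      ; unique      = order-unique
      ; other-side  = other-side
      ; covers      = covered ∘′ stuck⇒done st stuck
      ; alternating = alternating ∘′ stuck⇒done st stuck }
      where open Stage st

    -- The fuel k is n minus the number of done vertices, so it cannot run out while a next vertex exists.
    build : (k : ℕ) (st : Stage) → length (Stage.done st) + k ≡ n → SideOrder t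
    build k st size with Fin.any? (next? st)
    ... | no stuck = finish st (λ a next → stuck (a , next))
    build zero    st size | yes (a , _ , a∉done , _) =
      ⊥-elim (<-irrefl (trans (sym (+-identityʳ _)) size) (Unique⇒length≤ (¬Any⇒All¬ done a∉done ∷ done-unique)))
      where open Stage st
    build (suc k) st size | yes (a , next) =
      build k (advance st a next) (trans (sym (+-suc (length (Stage.done st)) k)) size)

  sideOrder : ∀ t → SideOrder t
  sideOrder t with Fin.any? (λ v → side v Bool.≟ t)
  ... | yes (root , root-side) = Build.build t root root-side n (Build.initial t root root-side) refl
  ... | no none = record
    { order = [] ; unique = [] ; other-side = λ ()
    ; covers = λ u-side → ⊥-elim (none (_ , u-side))
    ; alternating = λ u-side → ⊥-elim (none (_ , u-side)) }

  open SideOrder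

  ordering : List (Fin n)
  ordering = order (sideOrder true) ++ order (sideOrder false)

  ordering-unique : Unique ordering
  ordering-unique = Unique.++⁺ (unique (sideOrder true)) (unique (sideOrder false))
    λ (m₁ , m₂) → not-¬ (other-side (sideOrder true) m₁) (other-side (sideOrder false) m₂)

  ∈-ordering : ∀ t → v ∈ order (sideOrder t) → v ∈ ordering
  ∈-ordering true  = ∈-++⁺ˡ
  ∈-ordering false = ∈-++⁺ʳ _

  -- Every vertex has a blue edge, whose other end covers it.
  ordering-complete : ∀ v → v ∈ ordering
  ordering-complete v with tally-suc⇒∃ (nbrOfColour isBlue v) (allFin n) (balanced v)
  ... | u , blue-vu = ∈-ordering (side u) (covers (sideOrder (side u)) refl (adj-sym (proj₁ (T-if⁻ (adj G v u) blue-vu))))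

  colours-ownSide≡[] : ∀ t → side u ≡ t → colours u (order (sideOrder (not t))) ≡ []
  colours-ownSide≡[] t u-side = colours-nonadjacent (All.tabulate λ m →
    sameSide⇒¬Adj (trans u-side (sym (trans (other-side (sideOrder (not t)) m) (not-involutive t)))))

  ordering-alternating : ∀ u → AltBlue G (colours u ordering)
  ordering-alternating u with side u in u-side
  ... | true  = subst (AltBlue G)
      (sym (trans (colours-++ u (order (sideOrder true)) (order (sideOrder false))) (trans (cong (colours u (order (sideOrder true)) ++_) (colours-ownSide≡[] true u-side))
                                            (List.++-identityʳ _))))
      (alternating (sideOrder true) u-side)
  ... | false = subst (AltBlue G)
      (sym (trans (colours-++ u (order (sideOrder true)) (order (sideOrder false))) (cong (_++ colours u (order (sideOrder false))) (colours-ownSide≡[] false u-side))))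
      (alternating (sideOrder false) u-side)

mainTheorem2 : (n : ℕ) (G : Graph n) → Cactus G → Bipartite G →
    (c : Colouring G) → Difference1 G c → Configurable G c
mainTheorem2 n G cactus (side , bipartite) (col , col-sym) balanced =
  (ordering , ordering-unique , ordering-complete) , ordering-alternating
  where open Configuring G col col-sym cactus balanced side bipartite
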